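{- (a) If a query can be maintained in $\Delta\text{ - }\mathrm{DynUCQ}^{\neg}$, then it can be maintained in $\mathrm{DynUCQ}^{\neg}$. (b) If a query can be maintained in $\Delta\text{ - }\mathrm{Dyn}\forall^*\mathrm{FO}$, then it can be maintained in $\mathrm{Dyn}\forall^*\mathrm{FO}$.
   Context: Dynamic complexity. A dynamic schema is a pair $(\tau_{in},\tau_{aux})$ of disjoint finite relational schemas; $\tau=\tau_{in}\cup\tau_{aux}$. A modification is $\mathrm{ins}_S(\vec a)$ or $\mathrm{del}_S(\vec a)$ for $S\in\tau_{in}$ and a tuple $\vec a$ of the arity of $S$. A state is $(D,\mathcal I,\mathcal A)$ with finite domain $D$, a $\tau_{in}$-database $\mathcal I$ and a $\tau_{aux}$-database $\mathcal A$. Absolute semantics: an update program assigns to every $R\in\tau_{aux}$ and $\delta\in\{\mathrm{ins}_S,\mathrm{del}_S : S\in\tau_{in}\}$ a first-order formula $\phi^R_\delta(\vec u;\vec x)$ over $\tau$; applying $\delta(\vec a)$ to $\mathcal S$ gives $(D,\delta(\mathcal I),\mathcal A')$ with $R^{\mathcal A'}=\{\vec b:\mathcal S\models\phi^R_\delta(\vec a;\vec b)\}$. $\Delta$-semantics: a $\Delta$-update program assigns two formulas $\phi^{R^+}_\delta(\vec u;\vec x)$, $\phi^{R^- }_\delta(\vec u;\vec x)$ over $\tau$ with $\phi^{R^+}_\delta\wedge\phi^{R^- }_\delta$ unsatisfiable, and $R^{\mathcal A'}=(R^{\mathcal A}\cup\{\vec b:\mathcal S\models\phi^{R^+}_\delta(\vec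 a;\vec b)\})\setminus\{\vec b:\mathcal S\models\phi^{R^- }_\delta(\vec a;\vec b)\}$. A (resp. $\Delta$-)dynamic program is $(P,\mathrm{Init},Q)$ with $P$ a (resp. $\Delta$-)update program, $\mathrm{Init}$ an arbitrary mapping from $\tau_{in}$-databases to $\tau_{aux}$-databases over the same domain, and $Q\in\tau_{aux}$; it maintains $\mathcal Q$ if for every $\tau_{in}$-database $\mathcal D$ with domain $D$ and every finite modification sequence $\alpha$, $\mathcal Q(\alpha(\mathcal D))$ equals the interpretation of $Q$ in the state obtained from $(D,\mathcal D,\mathrm{Init}(\mathcal D))$ by applying $\alpha$. $\mathrm{Dyn}\mathcal C$ (resp. $\Delta\text{ - }\mathrm{Dyn}\mathcal C$) is the class of queries maintained by dynamic programs (resp. $\Delta$-programs) all of whose update formulas lie in $\mathcal C$. UCQ$^\neg$ = finite disjunctions of formulas $\exists\vec y\,\psi$ with $\psi$ a conjunction of literals; $\forall^*$FO = prenex first-order formulas with only universal quantifiers. -}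

module Defs where

open import Data.Nat using (ℕ; zero; suc; _+_)
open import Data.Fin using (Fin; zero; suc; _≟_)
open import Data.Vec using (Vec; []; _∷_; lookup; _++_; map)
open import Data.Vec.Properties using (≡-dec)
open import Data.Bool using (Bool; true; false; _∧_; _∨_; not)
open import Data.Sum using (_⊎_; inj₁; inj₂)
open import Data.Product using (Σ; _×_; _,_; proj₁; proj₂)
open import Data.List using (List; []; _∷_)
open import Relation.Nullary using (yes; no)
open import Relation.Binary.PropositionalEquality using (_≡_; refl; subst; sym)

record Schema : Set where
  field
    size  : ℕ
    arity : Fin size → ℕ
open Schema public

-- Finite domains are represented canonically as Fin n.
-- A k-ary relation over domain Fin n, as its (decidable) characteristic function.
Rel : ℕ → ℕ → Set
Rel n k = Vec (Fin n) k → Bool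

Database : Schema → ℕ → Set
Database σ n = (S : Fin (size σ)) → Rel n (arity σ S)

Sym : Schema → Schema → Set
Sym τi τa = Fin (size τi) ⊎ Fin (size τa)

symArity : (τi τa : Schema) → Sym τi τa → ℕ
symArity τi τa (inj₁ S) = arity τi S
symArity τi τa (inj₂ R) = arity τa R

-- First-order formulas over τ with equality; variables are de Bruijn
-- indices Fin v (v = number of variables in scope; index zero is the
-- most recently bound one).

data Formula (τi τa : Schema) : ℕ → Set where
  atom : ∀ {v} (r : Sym τi τa) → Vec (Fin v) (symArity τi τa r) → Formula τi τa v
  eq   : ∀ {v} → Fin v → Fin v → Formula τi τa v
  neg  : ∀ {v} → Formula τi τa v → Formula τi τa v
  conj : ∀ {v} → Formula τi τa v → Formula τi τa v → Formula τi τa v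
  disj : ∀ {v} → Formula τi τa v → Formula τi τa v → Formula τi τa v
  ex   : ∀ {v} → Formula τi τa (suc v) → Formula τi τa v
  fa   : ∀ {v} → Formula τi τa (suc v) → Formula τi τa v

anyFin : (n : ℕ) → (Fin n → Bool) → Bool
anyFin zero    f = false
anyFin (suc n) f = f zero ∨ anyFin n (λ i → f (suc i))

allFin : (n : ℕ) → (Fin n → Bool) → Bool
allFin zero    f = true
allFin (suc n) f = f zero ∧ allFin n (λ i → f (suc i))

eqFin : ∀ {n} → Fin n → Fin n → Bool
eqFin i j with i ≟ j
... | yes _ = true
... | no  _ = false

eval : ∀ {τi τa n v} → Database τi n → Database τa n →
       Formula τi τa v → Vec (Fin n) v → Bool
eval I A (atom (inj₁ S) ts) ρ = I S (map (lookup ρ) ts)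
eval I A (atom (inj₂ R) ts) ρ = A R (map (lookup ρ) ts)
eval I A (eq i j)   ρ = eqFin (lookup ρ i) (lookup ρ j)
eval I A (neg φ)    ρ = not (eval I A φ ρ)
eval I A (conj φ ψ) ρ = eval I A φ ρ ∧ eval I A ψ ρ
eval I A (disj φ ψ) ρ = eval I A φ ρ ∨ eval I A ψ ρ
eval {n = n} I A (ex φ) ρ = anyFin n (λ d → eval I A φ (d ∷ ρ))
eval {n = n} I A (fa φ) ρ = allFin n (λ d → eval I A φ (d ∷ ρ))

data Kind : Set where
  ins del : Kind

record Modification (τi : Schema) (n : ℕ) : Set where
  constructor mod
  field
    kind  : Kind
    symb  : Fin (size τi)
    tuple : Vec (Fin n) (arity τi symb)

kindVal : Kind → Bool
kindVal ins = true
kindVal del = false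

applyMod : ∀ {τi n} → Modification τi n → Database τi n → Database τi n
applyMod {τi} (mod k S a) I S' b with S' ≟ S
... | no _ = I S' b
... | yes refl with ≡-dec _≟_ b a
...   | yes _ = kindVal k
...   | no _  = I S' b

applyMods : ∀ {τi n} → List (Modification τi n) → Database τi n → Database τi n
applyMods []       I = I
applyMods (m ∷ ms) I = applyMods ms (applyMod m I)

-- Update programs. The formula φ^R_δ(u⃗; x⃗) for δ = kind_S has
-- arity(S) + arity(R) free variables: u⃗ first, then x⃗.

UpdFormula : (τi τa : Schema) → Fin (size τa) → Kind → Fin (size τi) → Set
UpdFormula τi τa R k S = Formula τi τa (arity τi S + arity τa R)

UpdateProgram : Schema → Schema → Set
UpdateProgram τi τa = (R : Fin (size τa)) (k : Kind) (S : Fin (size τi)) → UpdFormula τi τa R k S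

ΔUpdateProgram : Schema → Schema → Set
ΔUpdateProgram τi τa = (R : Fin (size τa)) (k : Kind) (S : Fin (size τi)) →
                       UpdFormula τi τa R k S × UpdFormula τi τa R k S

Unsat∧ : ∀ {τi τa v} → Formula τi τa v → Formula τi τa v → Set
Unsat∧ {τi} {τa} {v} φ ψ = (n : ℕ) (I : Database τi n) (A : Database τa n) (ρ : Vec (Fin n) v) →
                           (eval I A φ ρ ∧ eval I A ψ ρ) ≡ false

State : Schema → Schema → ℕ → Set
State τi τa n = Database τi n × Database τa n

step : ∀ {τi τa n} → UpdateProgram τi τa → Modification τi n → State τi τa n → State τi τa n
step P (mod k S a) (I , A) = applyMod (mod k S a) I , λ R b → eval I A (P R k S) (a ++ b)

Δstep : ∀ {τi τa n} → ΔUpdateProgram τi τa → Modification τi n → State τi τa n → State τi τa n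
Δstep P (mod k S a) (I , A) =
  applyMod (mod k S a) I ,
  λ R b → (A R b ∨ eval I A (proj₁ (P R k S)) (a ++ b)) ∧ not (eval I A (proj₂ (P R k S)) (a ++ b))

run : ∀ {τi τa n} → UpdateProgram τi τa → List (Modification τi n) → State τi τa n → State τi τa n
run P []       s = s
run P (m ∷ ms) s = run P ms (step P m s)

Δrun : ∀ {τi τa n} → ΔUpdateProgram τi τa → List (Modification τi n) → State τi τa n → State τi τa n
Δrun P []       s = s
Δrun P (m ∷ ms) s = Δrun P ms (Δstep P m s)

Query : Schema → ℕ → Set
Query τi k = (n : ℕ) → Database τi n → Rel n k

InitMap : Schema → Schema → Set
InitMap τi τa = (n : ℕ) → Database τi n → Database τa n

QuerySym : Schema → ℕ → Set
QuerySym τa k = Σ (Fin (size τa)) (λ Q → arity τa Q ≡ k)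

readQ : ∀ {τa n k} → QuerySym τa k → Database τa n → Rel n k
readQ {τa} {n} (Q , e) A b = A Q (subst (Vec (Fin n)) (sym e) b)

Maintains : ∀ {τi τa k} → UpdateProgram τi τa → InitMap τi τa → QuerySym τa k → Query τi k → Set
Maintains {τi} {τa} {k} P Init Q q =
  (n : ℕ) (D : Database τi n) (α : List (Modification τi n)) (b : Vec (Fin n) k) →
  q n (applyMods α D) b ≡ readQ Q (proj₂ (run P α (D , Init n D))) b

ΔMaintains : ∀ {τi τa k} → ΔUpdateProgram τi τa → InitMap τi τa → QuerySym τa k → Query τi k → Set
ΔMaintains {τi} {τa} {k} P Init Q q =
  (n : ℕ) (D : Database τi n) (α : List (Modification τi n)) (b : Vec (Fin n) k) →
  q n (applyMods α D) b ≡ readQ Q (proj₂ (Δrun P α (D , Init n D))) b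

Fragment : Set₁
Fragment = (τi τa : Schema) (v : ℕ) → Formula τi τa v → Set

data IsLiteral {τi τa : Schema} : {v : ℕ} → Formula τi τa v → Set where
  posAtom : ∀ {v} r (ts : Vec (Fin v) (symArity τi τa r)) → IsLiteral (atom r ts)
  negAtom : ∀ {v} r (ts : Vec (Fin v) (symArity τi τa r)) → IsLiteral (neg (atom r ts))
  posEq   : ∀ {v} (i j : Fin v) → IsLiteral {v = v} (eq i j)
  negEq   : ∀ {v} (i j : Fin v) → IsLiteral {v = v} (neg (eq i j))

data IsConjLit {τi τa : Schema} : {v : ℕ} → Formula τi τa v → Set where
  lit  : ∀ {v} {φ : Formula τi τa v} → IsLiteral φ → IsConjLit φ
  conj : ∀ {v} {φ ψ : Formula τi τa v} → IsConjLit φ → IsConjLit ψ → IsConjLit (conj φ ψ)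

data IsExConj {τi τa : Schema} : {v : ℕ} → Formula τi τa v → Set where
  matrix : ∀ {v} {φ : Formula τi τa v} → IsConjLit φ → IsExConj φ
  ex     : ∀ {v} {φ : Formula τi τa (suc v)} → IsExConj φ → IsExConj (ex φ)

data IsUCQ¬ {τi τa : Schema} : {v : ℕ} → Formula τi τa v → Set where
  cq   : ∀ {v} {φ : Formula τi τa v} → IsExConj φ → IsUCQ¬ φ
  disj : ∀ {v} {φ ψ : Formula τi τa v} → IsUCQ¬ φ → IsUCQ¬ ψ → IsUCQ¬ (disj φ ψ)

UCQ¬ : Fragment
UCQ¬ τi τa v φ = IsUCQ¬ φ

data IsQF {τi τa : Schema} : {v : ℕ} → Formula τi τa v → Set where
  atom : ∀ {v} r (ts : Vec (Fin v) (symArity τi τa r)) → IsQF (atom r ts)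
  eq   : ∀ {v} (i j : Fin v) → IsQF {v = v} (eq i j)
  neg  : ∀ {v} {φ : Formula τi τa v} → IsQF φ → IsQF (neg φ)
  conj : ∀ {v} {φ ψ : Formula τi τa v} → IsQF φ → IsQF ψ → IsQF (conj φ ψ)
  disj : ∀ {v} {φ ψ : Formula τi τa v} → IsQF φ → IsQF ψ → IsQF (disj φ ψ)

data IsUniv {τi τa : Schema} : {v : ℕ} → Formula τi τa v → Set where
  matrix : ∀ {v} {φ : Formula τi τa v} → IsQF φ → IsUniv φ
  fa     : ∀ {v} {φ : Formula τi τa (suc v)} → IsUniv φ → IsUniv (fa φ)

∀*FO : Fragment
∀*FO τi τa v φ = IsUniv φ

InDyn : Fragment → ∀ {τi k} → Query τi k → Set
InDyn C {τi} {k} q =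
  Σ Schema λ τa →
  Σ (UpdateProgram τi τa) λ P →
  ((R : Fin (size τa)) (δ : Kind) (S : Fin (size τi)) → C τi τa _ (P R δ S)) ×
  Σ (InitMap τi τa) λ Init →
  Σ (QuerySym τa k) λ Q →
  Maintains P Init Q q

InΔDyn : Fragment → ∀ {τi k} → Query τi k → Set
InΔDyn C {τi} {k} q =
  Σ Schema λ τa →
  Σ (ΔUpdateProgram τi τa) λ P →
  ((R : Fin (size τa)) (δ : Kind) (S : Fin (size τi)) →
     C τi τa _ (proj₁ (P R δ S)) × C τi τa _ (proj₂ (P R δ S)) ×
     Unsat∧ (proj₁ (P R δ S)) (proj₂ (P R δ S))) ×
  Σ (InitMap τi τa) λ Init →
  Σ (QuerySym τa k) λ Q →
  ΔMaintains P Init Q q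

-- A Δ-program is simulated by an absolute program that stores, next to each
-- auxiliary relation R, relations T^{R±}_δ(u⃗, x⃗) holding the current values of the
-- update formulas φ^{R±}_δ(u⃗; x⃗).  After δ(a⃗) the new R is
-- (R ∧ ¬T^{R-}_δ(a⃗, x⃗)) ∨ (T^{R+}_δ(a⃗, x⃗) ∧ ¬T^{R-}_δ(a⃗, x⃗)), and the new T's are
-- obtained by substituting into φ^{R±}_{δ'} definitions of the relations after δ(a⃗)
-- in terms of the old ones; the modified input relation becomes S(x⃗) ∨ x⃗ = a⃗ or
-- S(x⃗) ∧ x⃗ ≠ a⃗.  All these definitions and their negations are quantifier-free
-- DNFs, so substitution maps ∀*FO into ∀*FO, and, after distributing ∧ and ∃ over
-- ∨, UCQ¬ into UCQ¬.

module Submission where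

open import Defs
open import Algebra.Bundles using (CommutativeMonoid)
open import Data.Bool using (Bool; true; false; _∧_; _∨_; not; if_then_else_)
open import Data.Bool.Properties
  using (∨-commutativeMonoid; ∨-assoc; ∨-identityʳ; ∨-inverseˡ; ∨-inverseʳ; ∧-assoc; ∧-zeroʳ; ∧-inverseʳ;
         ∧-distribˡ-∨; ∧-distribʳ-∨; ∨-∧-booleanAlgebra; not-involutive)
open import Algebra.Properties.CommutativeSemigroup
  (CommutativeMonoid.commutativeSemigroup ∨-commutativeMonoid) using (interchange)
open import Algebra.Lattice.Properties.BooleanAlgebra ∨-∧-booleanAlgebra
  using (deMorgan₁; deMorgan₂)
open import Data.Empty using (⊥-elim)
open import Data.Fin using (Fin; zero; suc; _≟_; _↑ˡ_; _↑ʳ_; splitAt; combine; remQuot; lift)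
open import Data.Fin.Properties using (splitAt-↑ˡ; splitAt-↑ʳ; remQuot-combine)
open import Data.List as List using (List; []; _∷_; cartesianProductWith)
open import Data.Nat using (ℕ; zero; suc; _+_; _*_)
open import Data.Nat.Properties using (≡-irrelevant)
open import Data.Product using (Σ; _×_; _,_; proj₁; proj₂)
open import Data.Sum using (inj₁; inj₂; [_,_]′)
open import Data.Vec as Vec using (Vec; []; _∷_; lookup; map; tabulate; _++_)
open import Data.Vec.Properties
  using (≡-dec; map-∘; map-cong; map-++; lookup-++ˡ; lookup-++ʳ; tabulate-∘; tabulate-cong;
         tabulate∘lookup; map-lookup-allFin)
open import Function using (_∘_)
open import Relation.Binary.PropositionalEquality
open import Relation.Nullary using (Dec; yes; no; does; ¬_)

anyFin-cong : ∀ n {f g : Fin n → Bool} → (∀ d → f d ≡ g d) → anyFin n f ≡ anyFin n g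
anyFin-cong zero    f≗g = refl
anyFin-cong (suc n) f≗g = cong₂ _∨_ (f≗g zero) (anyFin-cong n (f≗g ∘ suc))

allFin-cong : ∀ n {f g : Fin n → Bool} → (∀ d → f d ≡ g d) → allFin n f ≡ allFin n g
allFin-cong zero    f≗g = refl
allFin-cong (suc n) f≗g = cong₂ _∧_ (f≗g zero) (allFin-cong n (f≗g ∘ suc))

anyFin-∨ : ∀ n (f g : Fin n → Bool) → anyFin n (λ d → f d ∨ g d) ≡ anyFin n f ∨ anyFin n g
anyFin-∨ zero    f g = refl
anyFin-∨ (suc n) f g =
  trans (cong ((f zero ∨ g zero) ∨_) (anyFin-∨ n (f ∘ suc) (g ∘ suc)))
        (interchange (f zero) (g zero) (anyFin n (f ∘ suc)) (anyFin n (g ∘ suc)))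

anyFin-false : ∀ n → anyFin n (λ _ → false) ≡ false
anyFin-false zero    = refl
anyFin-false (suc n) = anyFin-false n

eqFin-does : ∀ {n} (i j : Fin n) → eqFin i j ≡ does (i ≟ j)
eqFin-does i j with i ≟ j
... | yes _ = refl
... | no  _ = refl

sameTuple : ∀ {n k} → Vec (Fin n) k → Vec (Fin n) k → Bool
sameTuple b c = does (≡-dec _≟_ b c)

update : Kind → Bool → Bool → Bool
update k hit old = if hit then kindVal k else old

update-ins⁺ : ∀ hit old → old ∨ ((hit ∧ not old) ∨ false) ≡ update ins hit old
update-ins⁺ true  old = trans (cong (old ∨_) (∨-identityʳ (not old))) (∨-inverseʳ old)
update-ins⁺ false old = ∨-identityʳ old

update-del⁺ : ∀ hit old → not hit ∧ old ≡ update del hit old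
update-del⁺ true  old = refl
update-del⁺ false old = refl

update-ins⁻ : ∀ hit old → not hit ∧ not old ≡ not (update ins hit old)
update-ins⁻ true  old = refl
update-ins⁻ false old = refl

update-del⁻ : ∀ hit old → not old ∨ ((hit ∧ old) ∨ false) ≡ not (update del hit old)
update-del⁻ true  old = trans (cong (not old ∨_) (∨-identityʳ old)) (∨-inverseˡ old)
update-del⁻ false old = ∨-identityʳ (not old)

applyMod-self : ∀ {τi n k S a} (I : Database τi n) b →
                applyMod (mod k S a) I S b ≡ update k (sameTuple b a) (I S b)
applyMod-self {S = S} {a} I b with S ≟ S
... | no S≢S = ⊥-elim (S≢S refl)
... | yes refl with ≡-dec _≟_ b a
...   | yes _ = refl
...   | no  _ = refl

applyMod-other : ∀ {τi n k S S₁ a} (I : Database τi n) b → ¬ S₁ ≡ S →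
                 applyMod (mod k S a) I S₁ b ≡ I S₁ b
applyMod-other {S = S} {S₁} I b S₁≢S with S₁ ≟ S
... | yes S₁≡S = ⊥-elim (S₁≢S S₁≡S)
... | no  _    = refl

relOf : ∀ {σi σa n} → Database σi n → Database σa n → (r : Sym σi σa) → Rel n (symArity σi σa r)
relOf I A (inj₁ S) = I S
relOf I A (inj₂ R) = A R

eval-atom : ∀ {σi σa n v} (I : Database σi n) (A : Database σa n) r ts (ρ : Vec (Fin n) v) →
            eval I A (atom r ts) ρ ≡ relOf I A r (map (lookup ρ) ts)
eval-atom I A (inj₁ S) ts ρ = refl
eval-atom I A (inj₂ R) ts ρ = refl

-- How a formula with v free variables is placed in a context of w variables,
-- p of which hold the parameters of a definition.
record Binding (p v w : ℕ) : Set where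
  constructor binding
  field
    rename : Fin v → Fin w
    params : Vec (Fin w) p
open Binding

under : ∀ {p v w} → Binding p v w → Binding p (suc v) (suc w)
under β = binding (lift 1 (rename β)) (map suc (params β))

top : ∀ p v → Binding p v (p + v)
top p v = binding (p ↑ʳ_) (tabulate (_↑ˡ v))

record Matches {n p v w} (β : Binding p v w) (a : Vec (Fin n) p)
               (ρ : Vec (Fin n) v) (ρ' : Vec (Fin n) w) : Set where
  field
    rename-agrees : ∀ i → lookup ρ' (rename β i) ≡ lookup ρ i
    params-agree  : map (lookup ρ') (params β) ≡ a
open Matches

matches-under : ∀ {n p v w} {β : Binding p v w} {a ρ ρ'} → Matches {n} β a ρ ρ' →
                ∀ d → Matches (under β) a (d ∷ ρ) (d ∷ ρ')
matches-under μ d .rename-agrees zero    = refl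
matches-under μ d .rename-agrees (suc i) = rename-agrees μ i
matches-under {β = β} μ d .params-agree =
  trans (sym (map-∘ (lookup (d ∷ _)) suc (params β))) (params-agree μ)

matches-top : ∀ {n p v} (a : Vec (Fin n) p) (b : Vec (Fin n) v) → Matches (top p v) a b (a ++ b)
matches-top a b .rename-agrees = lookup-++ʳ a b
matches-top {v = v} a b .params-agree =
  trans (sym (tabulate-∘ (lookup (a ++ b)) (_↑ˡ v)))
        (trans (tabulate-cong (lookup-++ˡ a b)) (tabulate∘lookup a))

map-rename : ∀ {n p v w j} {β : Binding p v w} {a ρ ρ'} → Matches {n} β a ρ ρ' →
             (ts : Vec (Fin v) j) → map (lookup ρ') (map (rename β) ts) ≡ map (lookup ρ) ts
map-rename {β = β} μ ts = trans (sym (map-∘ _ (rename β) ts)) (map-cong (rename-agrees μ) ts)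

-- Substituting definitions for atoms

module AtomSubstitution {σi σa τi τa : Schema} (p : ℕ) where

  AtomDefinition : Set
  AtomDefinition = ∀ {w} (r : Sym σi σa) → Vec (Fin w) p → Vec (Fin w) (symArity σi σa r) →
                   Formula τi τa w

  Defines : ∀ {n} → AtomDefinition → Database τi n → Database τa n → Vec (Fin n) p →
            Database σi n → Database σa n → Set
  Defines {n} θ I A a I₀ A₀ =
    ∀ {w} r us ts (ρ : Vec (Fin n) w) → map (lookup ρ) us ≡ a →
    eval I A (θ r us ts) ρ ≡ relOf I₀ A₀ r (map (lookup ρ) ts)

  substAtoms : ∀ {v w} → AtomDefinition → Formula σi σa v → Binding p v w → Formula τi τa w
  substAtoms θ (atom r ts) β = θ r (params β) (map (rename β) ts)
  substAtoms θ (eq i j)    β = eq (rename β i) (rename β j)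
  substAtoms θ (neg φ)     β = neg (substAtoms θ φ β)
  substAtoms θ (conj φ ψ)  β = conj (substAtoms θ φ β) (substAtoms θ ψ β)
  substAtoms θ (disj φ ψ)  β = disj (substAtoms θ φ β) (substAtoms θ ψ β)
  substAtoms θ (ex φ)      β = ex (substAtoms θ φ (under β))
  substAtoms θ (fa φ)      β = fa (substAtoms θ φ (under β))

  eval-substAtoms : ∀ {n v w} {θ : AtomDefinition} {I : Database τi n} {A a I₀ A₀} →
                    Defines θ I A a I₀ A₀ → (φ : Formula σi σa v) → ∀ {β : Binding p v w} {ρ ρ'} → Matches β a ρ ρ' →
                    eval I A (substAtoms θ φ β) ρ' ≡ eval I₀ A₀ φ ρ
  eval-substAtoms {I₀ = I₀} {A₀} θ-defines (atom r ts) {β} {ρ} {ρ'} μ =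
    trans (θ-defines r (params β) _ ρ' (params-agree μ))
          (trans (cong (relOf I₀ A₀ r) (map-rename μ ts)) (sym (eval-atom I₀ A₀ r ts ρ)))
  eval-substAtoms θ-defines (eq i j)   μ = cong₂ eqFin (rename-agrees μ i) (rename-agrees μ j)
  eval-substAtoms θ-defines (neg φ)    μ = cong not (eval-substAtoms θ-defines φ μ)
  eval-substAtoms θ-defines (conj φ ψ) μ =
    cong₂ _∧_ (eval-substAtoms θ-defines φ μ) (eval-substAtoms θ-defines ψ μ)
  eval-substAtoms θ-defines (disj φ ψ) μ =
    cong₂ _∨_ (eval-substAtoms θ-defines φ μ) (eval-substAtoms θ-defines ψ μ)
  eval-substAtoms {n} θ-defines (ex φ) μ =
    anyFin-cong n (λ d → eval-substAtoms θ-defines φ (matches-under μ d))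
  eval-substAtoms {n} θ-defines (fa φ) μ =
    allFin-cong n (λ d → eval-substAtoms θ-defines φ (matches-under μ d))

  substAtoms-QF : ∀ {v w} {θ : AtomDefinition} → (∀ {w} r us ts → IsQF (θ {w} r us ts)) →
                  {φ : Formula σi σa v} → IsQF φ → (β : Binding p v w) → IsQF (substAtoms θ φ β)
  substAtoms-QF θ-QF (atom r ts) β = θ-QF r _ _
  substAtoms-QF θ-QF (eq i j)    β = eq _ _
  substAtoms-QF θ-QF (neg q)     β = neg (substAtoms-QF θ-QF q β)
  substAtoms-QF θ-QF (conj q q') β = conj (substAtoms-QF θ-QF q β) (substAtoms-QF θ-QF q' β)
  substAtoms-QF θ-QF (disj q q') β = disj (substAtoms-QF θ-QF q β) (substAtoms-QF θ-QF q' β)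

  substAtoms-univ : ∀ {v w} {θ : AtomDefinition} → (∀ {w} r us ts → IsQF (θ {w} r us ts)) →
                    {φ : Formula σi σa v} → IsUniv φ → (β : Binding p v w) →
                    IsUniv (substAtoms θ φ β)
  substAtoms-univ θ-QF (matrix q) β = matrix (substAtoms-QF θ-QF q β)
  substAtoms-univ θ-QF (fa u)     β = fa (substAtoms-univ θ-QF u (under β))

-- Disjunctive normal forms

Clause : Schema → Schema → ℕ → Set
Clause τi τa w = Σ (Formula τi τa w) IsConjLit

CQ : Schema → Schema → ℕ → Set
CQ τi τa w = Σ (Formula τi τa w) IsExConj

module _ {τi τa : Schema} where

  litPos litNeg : ∀ {w} r → Vec (Fin w) (symArity τi τa r) → Clause τi τa w
  litPos r ts = atom r ts , lit (posAtom r ts)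
  litNeg r ts = neg (atom r ts) , lit (negAtom r ts)

  litEq litNeq : ∀ {w} → Fin w → Fin w → Clause τi τa w
  litEq  i j = eq i j , lit (posEq i j)
  litNeq i j = neg (eq i j) , lit (negEq i j)

  _∧ᶜ_ : ∀ {w} → Clause τi τa w → Clause τi τa w → Clause τi τa w
  (φ , c) ∧ᶜ (ψ , d) = conj φ ψ , conj c d

  withEqs : ∀ {w j} → Clause τi τa w → Vec (Fin w) j → Vec (Fin w) j → Clause τi τa w
  withEqs c []       []       = c
  withEqs c (x ∷ xs) (y ∷ ys) = litEq x y ∧ᶜ withEqs c xs ys

  withNeqs : ∀ {w j} → Clause τi τa w → Vec (Fin w) j → Vec (Fin w) j → List (Clause τi τa w)
  withNeqs c []       []       = []
  withNeqs c (x ∷ xs) (y ∷ ys) = (litNeq x y ∧ᶜ c) ∷ withNeqs c xs ys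

  asCQ : ∀ {w} → Clause τi τa w → CQ τi τa w
  asCQ (φ , c) = φ , matrix c

  ∃CQ : ∀ {w} → CQ τi τa (suc w) → CQ τi τa w
  ∃CQ (φ , e) = ex φ , ex e

  -- ⊥φ must be false; it stands in for the empty disjunction, which Formula lacks.
  disjoin : ∀ {w} {P : Formula τi τa w → Set} → Formula τi τa w → List (Σ _ P) → Formula τi τa w
  disjoin ⊥φ []       = ⊥φ
  disjoin ⊥φ (c ∷ cs) = disj (proj₁ c) (disjoin ⊥φ cs)

  clause-QF : ∀ {w} {φ : Formula τi τa w} → IsConjLit φ → IsQF φ
  clause-QF (lit (posAtom r ts)) = atom r ts
  clause-QF (lit (negAtom r ts)) = neg (atom r ts)
  clause-QF (lit (posEq i j))    = eq i j
  clause-QF (lit (negEq i j))    = neg (eq i j)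
  clause-QF (conj c d)           = conj (clause-QF c) (clause-QF d)

  disjoin-QF : ∀ {w} {⊥φ : Formula τi τa w} → IsQF ⊥φ → (cs : List (Clause τi τa w)) →
               IsQF (disjoin ⊥φ cs)
  disjoin-QF ⊥-QF []       = ⊥-QF
  disjoin-QF ⊥-QF (c ∷ cs) = disj (clause-QF (proj₂ c)) (disjoin-QF ⊥-QF cs)

  disjoin-UCQ : ∀ {w} {⊥φ : Formula τi τa w} → IsUCQ¬ ⊥φ → (cs : List (CQ τi τa w)) →
                IsUCQ¬ (disjoin ⊥φ cs)
  disjoin-UCQ ⊥-UCQ []       = ⊥-UCQ
  disjoin-UCQ ⊥-UCQ (c ∷ cs) = disj (cq (proj₂ c)) (disjoin-UCQ ⊥-UCQ cs)

  module _ {n} (I : Database τi n) (A : Database τa n) where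

    evalAny : ∀ {w} {P : Formula τi τa w → Set} → List (Σ _ P) → Vec (Fin n) w → Bool
    evalAny []       ρ = false
    evalAny (c ∷ cs) ρ = eval I A (proj₁ c) ρ ∨ evalAny cs ρ

    eval-disjoin : ∀ {w} {P : Formula τi τa w → Set} ⊥φ (cs : List (Σ _ P)) ρ →
                   eval I A ⊥φ ρ ≡ false → eval I A (disjoin ⊥φ cs) ρ ≡ evalAny cs ρ
    eval-disjoin ⊥φ []       ρ ⊥-false = ⊥-false
    eval-disjoin ⊥φ (c ∷ cs) ρ ⊥-false = cong (_ ∨_) (eval-disjoin ⊥φ cs ρ ⊥-false)

    evalAny-++ : ∀ {w} {P : Formula τi τa w → Set} (cs ds : List (Σ _ P)) ρ →
                 evalAny (cs List.++ ds) ρ ≡ evalAny cs ρ ∨ evalAny ds ρ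
    evalAny-++ []       ds ρ = refl
    evalAny-++ (c ∷ cs) ds ρ =
      trans (cong (_ ∨_) (evalAny-++ cs ds ρ)) (sym (∨-assoc (eval I A (proj₁ c) ρ) _ _))

    evalAny-∧ᶜ : ∀ {w} (c : Clause τi τa w) ds ρ →
                 evalAny (List.map (c ∧ᶜ_) ds) ρ ≡ eval I A (proj₁ c) ρ ∧ evalAny ds ρ
    evalAny-∧ᶜ c []       ρ = sym (∧-zeroʳ _)
    evalAny-∧ᶜ c (d ∷ ds) ρ =
      trans (cong (_ ∨_) (evalAny-∧ᶜ c ds ρ))
            (sym (∧-distribˡ-∨ (eval I A (proj₁ c) ρ) (eval I A (proj₁ d) ρ) _))

    evalAny-⊗ : ∀ {w} (cs ds : List (Clause τi τa w)) ρ →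
                evalAny (cartesianProductWith _∧ᶜ_ cs ds) ρ ≡ evalAny cs ρ ∧ evalAny ds ρ
    evalAny-⊗ []       ds ρ = refl
    evalAny-⊗ (c ∷ cs) ds ρ =
      trans (evalAny-++ (List.map (c ∧ᶜ_) ds) _ ρ)
            (trans (cong₂ _∨_ (evalAny-∧ᶜ c ds ρ) (evalAny-⊗ cs ds ρ))
                   (sym (∧-distribʳ-∨ (evalAny ds ρ) (eval I A (proj₁ c) ρ) _)))

    evalAny-asCQ : ∀ {w} (cs : List (Clause τi τa w)) ρ →
                   evalAny (List.map asCQ cs) ρ ≡ evalAny cs ρ
    evalAny-asCQ []       ρ = refl
    evalAny-asCQ (c ∷ cs) ρ = cong (_ ∨_) (evalAny-asCQ cs ρ)

    evalAny-∃CQ : ∀ {w} (cs : List (CQ τi τa (suc w))) ρ →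
                  evalAny (List.map ∃CQ cs) ρ ≡ anyFin n (λ d → evalAny cs (d ∷ ρ))
    evalAny-∃CQ []       ρ = sym (anyFin-false n)
    evalAny-∃CQ (c ∷ cs) ρ =
      trans (cong (_ ∨_) (evalAny-∃CQ cs ρ))
            (sym (anyFin-∨ n (λ d → eval I A (proj₁ c) (d ∷ ρ)) (λ d → evalAny cs (d ∷ ρ))))

    eval-withEqs : ∀ {w j} (c : Clause τi τa w) (xs ys : Vec (Fin w) j) ρ →
                   eval I A (proj₁ (withEqs c xs ys)) ρ ≡
                   sameTuple (map (lookup ρ) xs) (map (lookup ρ) ys) ∧ eval I A (proj₁ c) ρ
    eval-withEqs c []       []       ρ = refl
    eval-withEqs c (x ∷ xs) (y ∷ ys) ρ =
      trans (cong₂ _∧_ (eqFin-does (lookup ρ x) (lookup ρ y)) (eval-withEqs c xs ys ρ))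
            (sym (∧-assoc (does (lookup ρ x ≟ lookup ρ y)) _ _))

    evalAny-withNeqs : ∀ {w j} (c : Clause τi τa w) (xs ys : Vec (Fin w) j) ρ →
                       evalAny (withNeqs c xs ys) ρ ≡
                       not (sameTuple (map (lookup ρ) xs) (map (lookup ρ) ys)) ∧ eval I A (proj₁ c) ρ
    evalAny-withNeqs c []       []       ρ = refl
    evalAny-withNeqs c (x ∷ xs) (y ∷ ys) ρ = begin
      not (eqFin ρx ρy) ∧ γ ∨ evalAny (withNeqs c xs ys) ρ
        ≡⟨ cong₂ (λ e f → not e ∧ γ ∨ f) (eqFin-does ρx ρy) (evalAny-withNeqs c xs ys ρ) ⟩
      not e ∧ γ ∨ not E ∧ γ    ≡⟨ ∧-distribʳ-∨ γ (not e) (not E) ⟨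
      (not e ∨ not E) ∧ γ      ≡⟨ cong (_∧ γ) (deMorgan₁ e E) ⟨
      not (e ∧ E) ∧ γ          ∎
      where
        open ≡-Reasoning
        ρx = lookup ρ x
        ρy = lookup ρ y
        γ = eval I A (proj₁ c) ρ
        e = does (ρx ≟ ρy)
        E = sameTuple (map (lookup ρ) xs) (map (lookup ρ) ys)

module UCQSubstitution {σi σa τi τa : Schema} (p : ℕ) where

  AtomDNF : Set
  AtomDNF = ∀ {w} (r : Sym σi σa) → Vec (Fin w) p → Vec (Fin w) (symArity σi σa r) →
            List (Clause τi τa w)

  DefinesDNF : ∀ {n} → AtomDNF → AtomDNF → Database τi n → Database τa n → Vec (Fin n) p →
               Database σi n → Database σa n → Set
  DefinesDNF {n} θ⁺ θ⁻ I A a I₀ A₀ =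
    ∀ {w} r us ts (ρ : Vec (Fin n) w) → map (lookup ρ) us ≡ a →
    evalAny I A (θ⁺ r us ts) ρ ≡ relOf I₀ A₀ r (map (lookup ρ) ts) ×
    evalAny I A (θ⁻ r us ts) ρ ≡ not (relOf I₀ A₀ r (map (lookup ρ) ts))

  module _ (θ⁺ θ⁻ : AtomDNF) where

    substConj : ∀ {v w} {φ : Formula σi σa v} → IsConjLit φ → Binding p v w → List (Clause τi τa w)
    substConj (lit (posAtom r ts)) β = θ⁺ r (params β) (map (rename β) ts)
    substConj (lit (negAtom r ts)) β = θ⁻ r (params β) (map (rename β) ts)
    substConj (lit (posEq i j))    β = litEq  (rename β i) (rename β j) ∷ []
    substConj (lit (negEq i j))    β = litNeq (rename β i) (rename β j) ∷ []
    substConj (conj c d)           β = cartesianProductWith _∧ᶜ_ (substConj c β) (substConj d β)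

    substCQ : ∀ {v w} {φ : Formula σi σa v} → IsExConj φ → Binding p v w → List (CQ τi τa w)
    substCQ (matrix c) β = List.map asCQ (substConj c β)
    substCQ (ex e)     β = List.map ∃CQ (substCQ e (under β))

    substUCQ : ∀ {v w} {φ : Formula σi σa v} → IsUCQ¬ φ → Binding p v w → List (CQ τi τa w)
    substUCQ (cq e)      β = substCQ e β
    substUCQ (disj u u') β = substUCQ u β List.++ substUCQ u' β

    module _ {n} {I : Database τi n} {A a I₀ A₀} (defines : DefinesDNF θ⁺ θ⁻ I A a I₀ A₀) where

      eval-substConj : ∀ {v w} {φ : Formula σi σa v} (c : IsConjLit φ) → ∀ {β : Binding p v w} {ρ ρ'} →
                       Matches β a ρ ρ' → evalAny I A (substConj c β) ρ' ≡ eval I₀ A₀ φ ρ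
      eval-substConj (lit (posAtom r ts)) {β} {ρ} {ρ'} μ =
        trans (proj₁ (defines r (params β) _ ρ' (params-agree μ)))
              (trans (cong (relOf I₀ A₀ r) (map-rename μ ts)) (sym (eval-atom I₀ A₀ r ts ρ)))
      eval-substConj (lit (negAtom r ts)) {β} {ρ} {ρ'} μ =
        trans (proj₂ (defines r (params β) _ ρ' (params-agree μ)))
              (cong not (trans (cong (relOf I₀ A₀ r) (map-rename μ ts))
                               (sym (eval-atom I₀ A₀ r ts ρ))))
      eval-substConj (lit (posEq i j)) μ =
        trans (∨-identityʳ _) (cong₂ eqFin (rename-agrees μ i) (rename-agrees μ j))
      eval-substConj (lit (negEq i j)) μ =
        trans (∨-identityʳ _) (cong not (cong₂ eqFin (rename-agrees μ i) (rename-agrees μ j)))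
      eval-substConj (conj c d) {β} μ =
        trans (evalAny-⊗ I A (substConj c β) (substConj d β) _)
              (cong₂ _∧_ (eval-substConj c μ) (eval-substConj d μ))

      eval-substCQ : ∀ {v w} {φ : Formula σi σa v} (e : IsExConj φ) → ∀ {β : Binding p v w} {ρ ρ'} →
                     Matches β a ρ ρ' → evalAny I A (substCQ e β) ρ' ≡ eval I₀ A₀ φ ρ
      eval-substCQ (matrix c) {β} μ = trans (evalAny-asCQ I A (substConj c β) _) (eval-substConj c μ)
      eval-substCQ (ex e) {β} μ =
        trans (evalAny-∃CQ I A (substCQ e (under β)) _)
              (anyFin-cong n (λ d → eval-substCQ e (matches-under μ d)))

      eval-substUCQ : ∀ {v w} {φ : Formula σi σa v} (u : IsUCQ¬ φ) → ∀ {β : Binding p v w} {ρ ρ'} →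
                      Matches β a ρ ρ' → evalAny I A (substUCQ u β) ρ' ≡ eval I₀ A₀ φ ρ
      eval-substUCQ (cq e) μ = eval-substCQ e μ
      eval-substUCQ (disj u u') {β} μ =
        trans (evalAny-++ I A (substUCQ u β) (substUCQ u' β) _)
              (cong₂ _∨_ (eval-substUCQ u μ) (eval-substUCQ u' μ))

module FinitelyIndexed {X : Set} (arityOf : X → ℕ) {N : ℕ}
                       (encode : X → Fin N) (decode : Fin N → X)
                       (decode-encode : ∀ x → decode (encode x) ≡ x) where

  schema : Schema
  schema = record { size = N ; arity = arityOf ∘ decode }

  cast : ∀ {A : Set} x → Vec A (arityOf x) → Vec A (arity schema (encode x))
  cast {A} x = subst (Vec A) (cong arityOf (sym (decode-encode x)))

  _!_ : ∀ {n} → Database schema n → (x : X) → Rel n (arityOf x)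
  (A ! x) b = A (encode x) (cast x b)

  atomAt : ∀ {τi w} (x : X) → Vec (Fin w) (arityOf x) → Formula τi schema w
  atomAt x ts = atom (inj₂ (encode x)) (cast x ts)

  eval-atomAt : ∀ {τi n w} (I : Database τi n) (A : Database schema n) x
                (ts : Vec (Fin w) (arityOf x)) ρ →
                eval I A (atomAt x ts) ρ ≡ (A ! x) (map (lookup ρ) ts)
  eval-atomAt I A x ts ρ =
    cong (A (encode x))
         (sym (subst-application′ (Vec _) {y = ts} (λ _ → map (lookup ρ))
                                  (cong arityOf (sym (decode-encode x)))))

  tabulateDB : ∀ {n} → ((x : X) → Rel n (arityOf x)) → Database schema n
  tabulateDB f i = f (decode i)

  tabulateDB-! : ∀ {n} (f : (x : X) → Rel n (arityOf x)) x b → (tabulateDB f ! x) b ≡ f x b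
  tabulateDB-! {n} f x b = transport (decode-encode x)
    where
      transport : ∀ {y} (y≡x : y ≡ x) → f y (subst (Vec (Fin n)) (cong arityOf (sym y≡x)) b) ≡ f x b
      transport refl = refl

  querySym : ∀ {k} x → arityOf x ≡ k → QuerySym schema k
  querySym x e = encode x , trans (cong arityOf (decode-encode x)) e

  readQ-querySym : ∀ {n k} x (e : arityOf x ≡ k) (A : Database schema n) b →
                   readQ (querySym x e) A b ≡ (A ! x) (subst (Vec (Fin n)) (sym e) b)
  readQ-querySym x refl A b = cong (λ e → A (encode x) (subst (Vec (Fin _)) e b)) (≡-irrelevant _ _)

-- Eliminating the Δ-semantics

Δupdate⁺ : ∀ {r p m r' p' m'} → r ≡ r' → p ≡ p' → m ≡ m' →
           (r ∧ not m) ∨ ((p ∧ not m) ∨ false) ≡ (r' ∨ p') ∧ not m'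
Δupdate⁺ {r} {p} {m} refl refl refl =
  trans (cong ((r ∧ not m) ∨_) (∨-identityʳ _)) (sym (∧-distribʳ-∨ (not m) r p))

Δupdate⁻ : ∀ {r p m r' p' m'} → r ≡ r' → p ≡ p' → m ≡ m' →
           (not r ∧ not p) ∨ (m ∨ false) ≡ not ((r' ∨ p') ∧ not m')
Δupdate⁻ {r} {p} {m} refl refl refl = begin
  (not r ∧ not p) ∨ (m ∨ false)    ≡⟨ cong (_ ∨_) (∨-identityʳ m) ⟩
  (not r ∧ not p) ∨ m              ≡⟨ cong₂ _∨_ (deMorgan₂ r p) (not-involutive m) ⟨
  not (r ∨ p) ∨ not (not m)        ≡⟨ deMorgan₁ (r ∨ p) (not m) ⟨
  not ((r ∨ p) ∧ not m)            ∎
  where open ≡-Reasoning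

module Elimination {τi τa : Schema} (P : ΔUpdateProgram τi τa) where

  private
    s = size τi
    m = size τa

  data Sign : Set where
    plus minus : Sign

  ΔP : Sign → (R : Fin m) (k : Kind) (S : Fin s) → UpdFormula τi τa R k S
  ΔP plus  R k S = proj₁ (P R k S)
  ΔP minus R k S = proj₂ (P R k S)

  data Aux : Set where
    copy  : Fin m → Aux
    delta : Sign → Kind → Fin s → Fin m → Aux

  auxArity : Aux → ℕ
  auxArity (copy R)        = arity τa R
  auxArity (delta _ _ S R) = arity τi S + arity τa R

  -- The auxiliary relation x always holds the current value of meaning x.
  meaning : (x : Aux) → Formula τi τa (auxArity x)
  meaning (copy R)         = atom (inj₂ R) (Vec.allFin _)
  meaning (delta sg k S R) = ΔP sg R k S

  tag : Sign → Kind → Fin 4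
  tag plus  ins = zero
  tag plus  del = suc zero
  tag minus ins = suc (suc zero)
  tag minus del = suc (suc (suc zero))

  untag : Fin 4 → Sign × Kind
  untag zero                   = plus , ins
  untag (suc zero)             = plus , del
  untag (suc (suc zero))       = minus , ins
  untag (suc (suc (suc zero))) = minus , del

  untag-tag : ∀ sg k → untag (tag sg k) ≡ (sg , k)
  untag-tag plus  ins = refl
  untag-tag plus  del = refl
  untag-tag minus ins = refl
  untag-tag minus del = refl

  encode : Aux → Fin (m + m * (4 * s))
  encode (copy R)         = R ↑ˡ (m * (4 * s))
  encode (delta sg k S R) = m ↑ʳ combine R (combine (tag sg k) S)

  fromParts : Fin m → Sign × Kind → Fin s → Aux
  fromParts R (sg , k) S = delta sg k S R

  decodeDelta : Fin m × Fin (4 * s) → Aux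
  decodeDelta (R , j) = fromParts R (untag (proj₁ (remQuot {4} s j))) (proj₂ (remQuot {4} s j))

  decode : Fin (m + m * (4 * s)) → Aux
  decode i = [ copy , decodeDelta ∘ remQuot {m} (4 * s) ]′ (splitAt m i)

  decode-encode : ∀ x → decode (encode x) ≡ x
  decode-encode (copy R) = cong [ copy , decodeDelta ∘ remQuot {m} (4 * s) ]′ (splitAt-↑ˡ m R _)
  decode-encode (delta sg k S R) =
    trans (cong [ copy , decodeDelta ∘ remQuot {m} (4 * s) ]′ (splitAt-↑ʳ m _ _))
    (trans (cong decodeDelta (remQuot-combine {m} {4 * s} R (combine (tag sg k) S)))
    (trans (cong (λ q → fromParts R (untag (proj₁ q)) (proj₂ q)) (remQuot-combine {4} {s} (tag sg k) S))
           (cong (λ sk → fromParts R sk S) (untag-tag sg k))))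

  open FinitelyIndexed auxArity encode decode decode-encode public

  Stores : ∀ {n} → Database τi n → Database τa n → Database schema n → Set
  Stores I A A' = ∀ x b → (A' ! x) b ≡ eval I A (meaning x) b

  eval-meaning-copy : ∀ {n} (I : Database τi n) A R b → eval I A (meaning (copy R)) b ≡ A R b
  eval-meaning-copy I A R b = cong (A R) (map-lookup-allFin b)

  stored unstored : ∀ {w} x → Vec (Fin w) (auxArity x) → Clause τi schema w
  stored   x ts = litPos (inj₂ (encode x)) (cast x ts)
  unstored x ts = litNeg (inj₂ (encode x)) (cast x ts)

  auxDNF⁺ auxDNF⁻ : ∀ {w} k S R → Vec (Fin w) (arity τi S) → Vec (Fin w) (arity τa R) →
                    List (Clause τi schema w)
  auxDNF⁺ k S R us ts =
    (stored (copy R) ts ∧ᶜ unstored (delta minus k S R) (us ++ ts)) ∷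
    (stored (delta plus k S R) (us ++ ts) ∧ᶜ unstored (delta minus k S R) (us ++ ts)) ∷ []
  auxDNF⁻ k S R us ts =
    (unstored (copy R) ts ∧ᶜ unstored (delta plus k S R) (us ++ ts)) ∷
    stored (delta minus k S R) (us ++ ts) ∷ []

  -- The literal ¬S(t⃗) (resp. S(t⃗)) keeps the equality clause non-empty when S is nullary.
  modified⁺ modified⁻ : ∀ {w} → Kind → (S : Fin s) → Vec (Fin w) (arity τi S) →
                        Vec (Fin w) (arity τi S) → List (Clause τi schema w)
  modified⁺ ins S ts us = litPos (inj₁ S) ts ∷ withEqs (litNeg (inj₁ S) ts) ts us ∷ []
  modified⁺ del S ts us = withNeqs (litPos (inj₁ S) ts) ts us
  modified⁻ ins S ts us = withNeqs (litNeg (inj₁ S) ts) ts us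
  modified⁻ del S ts us = litNeg (inj₁ S) ts ∷ withEqs (litPos (inj₁ S) ts) ts us ∷ []

  inputDNF⁺ inputDNF⁻ : ∀ {w} → Kind → (S : Fin s) {S₁ : Fin s} → Dec (S₁ ≡ S) →
                        Vec (Fin w) (arity τi S) → Vec (Fin w) (arity τi S₁) → List (Clause τi schema w)
  inputDNF⁺ k S (yes refl) us ts = modified⁺ k S ts us
  inputDNF⁺ k S {S₁} (no _) us ts = litPos (inj₁ S₁) ts ∷ []
  inputDNF⁻ k S (yes refl) us ts = modified⁻ k S ts us
  inputDNF⁻ k S {S₁} (no _) us ts = litNeg (inj₁ S₁) ts ∷ []

  module UCQ (S : Fin s) = UCQSubstitution {τi} {τa} {τi} {schema} (arity τi S)

  newDNF⁺ newDNF⁻ : Kind → (S : Fin s) → UCQ.AtomDNF S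
  newDNF⁺ k S (inj₁ S₁) us ts = inputDNF⁺ k S (S₁ ≟ S) us ts
  newDNF⁺ k S (inj₂ R)  us ts = auxDNF⁺ k S R us ts
  newDNF⁻ k S (inj₁ S₁) us ts = inputDNF⁻ k S (S₁ ≟ S) us ts
  newDNF⁻ k S (inj₂ R)  us ts = auxDNF⁻ k S R us ts

  module _ {n} (I : Database τi n) (A' : Database schema n) where

    evalAny-modified : ∀ {w} k S (ts us : Vec (Fin w) (arity τi S)) ρ →
      let hit = sameTuple (map (lookup ρ) ts) (map (lookup ρ) us)
          old = I S (map (lookup ρ) ts)
      in evalAny I A' (modified⁺ k S ts us) ρ ≡ update k hit old ×
         evalAny I A' (modified⁻ k S ts us) ρ ≡ not (update k hit old)
    evalAny-modified ins S ts us ρ =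
      trans (cong (λ z → old ∨ (z ∨ false)) (eval-withEqs I A' (litNeg (inj₁ S) ts) ts us ρ))
            (update-ins⁺ hit old) ,
      trans (evalAny-withNeqs I A' (litNeg (inj₁ S) ts) ts us ρ) (update-ins⁻ hit old)
      where
        hit old : Bool
        hit = sameTuple (map (lookup ρ) ts) (map (lookup ρ) us)
        old = I S (map (lookup ρ) ts)
    evalAny-modified del S ts us ρ =
      trans (evalAny-withNeqs I A' (litPos (inj₁ S) ts) ts us ρ) (update-del⁺ hit old) ,
      trans (cong (λ z → not old ∨ (z ∨ false)) (eval-withEqs I A' (litPos (inj₁ S) ts) ts us ρ))
            (update-del⁻ hit old)
      where
        hit old : Bool
        hit = sameTuple (map (lookup ρ) ts) (map (lookup ρ) us)
        old = I S (map (lookup ρ) ts)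

  module _ {n} {I : Database τi n} {A : Database τa n} {A' : Database schema n}
           (stores : Stores I A A') (k : Kind) (S : Fin s) (a : Vec (Fin n) (arity τi S)) where

    I₁ : Database τi n
    I₁ = applyMod (mod k S a) I

    A₁ : Database τa n
    A₁ = proj₂ (Δstep P (mod k S a) (I , A))

    defines-input : ∀ {w S₁} (S₁≟S : Dec (S₁ ≡ S)) us ts (ρ : Vec (Fin n) w) → map (lookup ρ) us ≡ a →
                    evalAny I A' (inputDNF⁺ k S S₁≟S us ts) ρ ≡ I₁ S₁ (map (lookup ρ) ts) ×
                    evalAny I A' (inputDNF⁻ k S S₁≟S us ts) ρ ≡ not (I₁ S₁ (map (lookup ρ) ts))
    defines-input (yes refl) us ts ρ us↦a =
      trans (proj₁ (evalAny-modified I A' k S ts us ρ)) new ,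
      trans (proj₂ (evalAny-modified I A' k S ts us ρ)) (cong not new)
      where
        b : Vec (Fin n) (arity τi S)
        b = map (lookup ρ) ts
        new : update k (sameTuple b (map (lookup ρ) us)) (I S b) ≡ I₁ S b
        new = trans (cong (λ a' → update k (sameTuple b a') (I S b)) us↦a)
                    (sym (applyMod-self {k = k} {S} {a} I b))
    defines-input (no S₁≢S) us ts ρ us↦a =
      trans (∨-identityʳ _) (sym (applyMod-other I _ S₁≢S)) ,
      trans (∨-identityʳ _) (cong not (sym (applyMod-other I _ S₁≢S)))

    defines-aux : ∀ {w} R us ts (ρ : Vec (Fin n) w) → map (lookup ρ) us ≡ a →
                  evalAny I A' (auxDNF⁺ k S R us ts) ρ ≡ A₁ R (map (lookup ρ) ts) ×
                  evalAny I A' (auxDNF⁻ k S R us ts) ρ ≡ not (A₁ R (map (lookup ρ) ts))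
    defines-aux R us ts ρ us↦a =
      Δupdate⁺ current (after plus) (after minus) , Δupdate⁻ current (after plus) (after minus)
      where
        b : Vec (Fin n) (arity τa R)
        b = map (lookup ρ) ts
        current : eval I A' (atomAt (copy R) ts) ρ ≡ A R b
        current = trans (eval-atomAt I A' (copy R) ts ρ)
                        (trans (stores (copy R) b) (eval-meaning-copy I A R b))
        after : ∀ sg → eval I A' (atomAt (delta sg k S R) (us ++ ts)) ρ ≡
                       eval I A (ΔP sg R k S) (a ++ b)
        after sg =
          trans (eval-atomAt I A' (delta sg k S R) (us ++ ts) ρ)
                (trans (cong (A' ! delta sg k S R) (trans (map-++ (lookup ρ) us ts) (cong (_++ b) us↦a)))
                       (stores (delta sg k S R) (a ++ b)))

    defines-step : UCQ.DefinesDNF S (newDNF⁺ k S) (newDNF⁻ k S) I A' a I₁ A₁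
    defines-step (inj₁ S₁) = defines-input (S₁ ≟ S)
    defines-step (inj₂ R)  = defines-aux R

  meaning-in : (C : Fragment) → (∀ {v} R (ts : Vec (Fin v) (arity τa R)) → C τi τa v (atom (inj₂ R) ts)) →
               (∀ R k S → C τi τa _ (proj₁ (P R k S)) × C τi τa _ (proj₂ (P R k S))) →
               ∀ x → C τi τa _ (meaning x)
  meaning-in C atom-in Δ-in (copy R)            = atom-in R _
  meaning-in C atom-in Δ-in (delta plus  k S R) = proj₁ (Δ-in R k S)
  meaning-in C atom-in Δ-in (delta minus k S R) = proj₂ (Δ-in R k S)

  Translation : Set
  Translation = (k : Kind) (S : Fin s) (x : Aux) → Formula τi schema (arity τi S + auxArity x)

  Sound : Translation → Set
  Sound translate =
    ∀ {n} {I : Database τi n} {A A'} → Stores I A A' → ∀ k S a x b →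
    eval I A' (translate k S x) (a ++ b) ≡
    eval (applyMod (mod k S a) I) (proj₂ (Δstep P (mod k S a) (I , A))) (meaning x) b

  module Simulation (translate : Translation) (sound : Sound translate) where

    P' : UpdateProgram τi schema
    P' R k S = translate k S (decode R)

    Init' : InitMap τi τa → InitMap τi schema
    Init' Init n D = tabulateDB (λ x → eval D (Init n D) (meaning x))

    stores-run : ∀ {n} (α : List (Modification τi n)) {I A A'} → Stores I A A' →
                 Stores (applyMods α I) (proj₂ (Δrun P α (I , A))) (proj₂ (run P' α (I , A')))
    stores-run []              stores = stores
    stores-run (mod k S a ∷ α) {I} {A} {A'} stores = stores-run α λ x b →
      trans (tabulateDB-! (λ y c → eval I A' (translate k S y) (a ++ c)) x b) (sound stores k S a x b)

    readQ-copy : ∀ {n k I A A'} → Stores {n} I A A' → (Q : QuerySym τa k) → ∀ b →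
                 readQ (querySym (copy (proj₁ Q)) (proj₂ Q)) A' b ≡ readQ Q A b
    readQ-copy {I = I} {A} {A'} stores (Q , e) b =
      trans (readQ-querySym (copy Q) e A' b) (trans (stores (copy Q) _) (eval-meaning-copy I A Q _))

    maintains : ∀ {k Init} {Q : QuerySym τa k} {q} → ΔMaintains P Init Q q →
                Maintains P' (Init' Init) (querySym (copy (proj₁ Q)) (proj₂ Q)) q
    maintains {Init = Init} {Q} Δmaintains n D α b =
      trans (Δmaintains n D α b)
            (sym (readQ-copy {A' = proj₂ (run P' α (D , Init' Init n D))}
                             (stores-run α {D} {Init n D} {Init' Init n D} (tabulateDB-! _)) Q b))

  eliminate : (C : Fragment) (translate : Translation) → Sound translate →
              (∀ k S x → C τi schema _ (translate k S x)) →
              ∀ {k} (Init : InitMap τi τa) (Q : QuerySym τa k) (q : Query τi k) →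
              ΔMaintains P Init Q q → InDyn C q
  eliminate C translate sound translate-in Init (Q , e) q Δmaintains =
    schema , P' , (λ R k S → translate-in k S (decode R)) , Init' Init , querySym (copy Q) e ,
    maintains {q = q} Δmaintains
    where open Simulation translate sound

  -- A false formula needing no variables besides the parameters u⃗.
  contradiction : ∀ {w} (S : Fin s) → Vec (Fin w) (arity τi S) → Clause τi schema w
  contradiction S us = litPos (inj₁ S) us ∧ᶜ litNeg (inj₁ S) us

  eval-contradiction : ∀ {n w} (I : Database τi n) (A' : Database schema n) S us (ρ : Vec (Fin n) w) →
                       eval I A' (proj₁ (contradiction S us)) ρ ≡ false
  eval-contradiction I A' S us ρ = ∧-inverseʳ (I S (map (lookup ρ) us))

  translateUCQ : (∀ x → IsUCQ¬ (meaning x)) → Translation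
  translateUCQ ucq k S x =
    disjoin (proj₁ (contradiction S (params (top _ _))))
            (UCQ.substUCQ S (newDNF⁺ k S) (newDNF⁻ k S) (ucq x) (top _ _))

  translateUCQ-sound : ∀ ucq → Sound (translateUCQ ucq)
  translateUCQ-sound ucq {I = I} {A' = A'} stores k S a x b =
    trans (eval-disjoin I A' _ cqs (a ++ b) (eval-contradiction I A' S _ (a ++ b)))
          (UCQ.eval-substUCQ S (newDNF⁺ k S) (newDNF⁻ k S) (defines-step stores k S a) (ucq x)
                             (matches-top a b))
    where
      cqs : List (CQ τi schema _)
      cqs = UCQ.substUCQ S (newDNF⁺ k S) (newDNF⁻ k S) (ucq x) (top _ _)

  translateUCQ-in : ∀ ucq k S x → IsUCQ¬ (translateUCQ ucq k S x)
  translateUCQ-in ucq k S x = disjoin-UCQ (cq (matrix (proj₂ (contradiction S _)))) _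

  module Subst (S : Fin s) = AtomSubstitution {τi} {τa} {τi} {schema} (arity τi S)

  newDefinition : (k : Kind) (S : Fin s) → Subst.AtomDefinition S
  newDefinition k S r us ts = disjoin (proj₁ (contradiction S us)) (newDNF⁺ k S r us ts)

  translate∀ : Translation
  translate∀ k S x = Subst.substAtoms S (newDefinition k S) (meaning x) (top _ _)

  translate∀-sound : Sound translate∀
  translate∀-sound {I = I} {A' = A'} stores k S a x b =
    Subst.eval-substAtoms S defines (meaning x) (matches-top a b)
    where
      defines : Subst.Defines S (newDefinition k S) I A' a _ _
      defines r us ts ρ us↦a =
        trans (eval-disjoin I A' _ (newDNF⁺ k S r us ts) ρ (eval-contradiction I A' S us ρ))
              (proj₁ (defines-step stores k S a r us ts ρ us↦a))

  translate∀-in : (∀ x → IsUniv (meaning x)) → ∀ k S x → IsUniv (translate∀ k S x)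
  translate∀-in univ k S x =
    Subst.substAtoms-univ S (λ r us ts → disjoin-QF (clause-QF (proj₂ (contradiction S us))) _)
                          (univ x) (top _ _)

ΔDynUCQ¬⊆DynUCQ¬ : (τi : Schema) (k : ℕ) (q : Query τi k) → InΔDyn UCQ¬ q → InDyn UCQ¬ q
ΔDynUCQ¬⊆DynUCQ¬ τi k q (τa , P , Δ-in , Init , Q , Δmaintains) =
  eliminate UCQ¬ (translateUCQ ucq) (translateUCQ-sound ucq) (translateUCQ-in ucq) Init Q q Δmaintains
  where
    open Elimination P
    ucq : ∀ x → IsUCQ¬ (meaning x)
    ucq = meaning-in UCQ¬ (λ R ts → cq (matrix (lit (posAtom (inj₂ R) ts))))
                          (λ R k S → proj₁ (Δ-in R k S) , proj₁ (proj₂ (Δ-in R k S)))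

ΔDyn∀*FO⊆Dyn∀*FO : (τi : Schema) (k : ℕ) (q : Query τi k) → InΔDyn ∀*FO q → InDyn ∀*FO q
ΔDyn∀*FO⊆Dyn∀*FO τi k q (τa , P , Δ-in , Init , Q , Δmaintains) =
  eliminate ∀*FO translate∀ translate∀-sound (translate∀-in univ) Init Q q Δmaintains
  where
    open Elimination P
    univ : ∀ x → IsUniv (meaning x)
    univ = meaning-in ∀*FO (λ R ts → matrix (atom (inj₂ R) ts))
                           (λ R k S → proj₁ (Δ-in R k S) , proj₁ (proj₂ (Δ-in R k S)))

lemma4p7 : ((τi : Schema) (k : ℕ) (q : Query τi k) → InΔDyn UCQ¬ q → InDyn UCQ¬ q)
         × ((τi : Schema) (k : ℕ) (q : Query τi k) → InΔDyn ∀*FO q → InDyn ∀*FO q)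
lemma4p7 = ΔDynUCQ¬⊆DynUCQ¬ , ΔDyn∀*FO⊆Dyn∀*FO
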